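{- Let $G$ be a graph of finite corner rank $\alpha\ge 2$. Then every Lower Way strategy is an optimal strategy for the cop on $G$, and every Higher Way strategy is an optimal strategy for the robber on $G$.
   Context: All graphs are finite, nonempty and reflexive (every vertex is adjacent to itself); $N[v]$ is the closed neighborhood. For distinct vertices $v,w$ of a graph $H$: $w$ corners $v$ in $H$ if every vertex of $H$ adjacent to $v$ is adjacent to $w$; $w$ strictly corners $v$ in $H$ if moreover some vertex of $H$ adjacent to $w$ is not adjacent to $v$; a strict corner of $H$ is a vertex strictly cornered in $H$ by another vertex. For a vertex set, "$c$ corners $x$ in $H$" is also used when $c=x$ (trivially true). Corner ranking: set $G_1=G$, $k=1$. If $G_k$ is a clique, give all its vertices rank $k$ and stop. Else if $G_k$ has no strict corners, give all its vertices rank $\infty$ and stop. Else give the set $X$ of strict corners of $G_k$ rank $k$, put $G_{k+1}=G_k-X$ (induced subgraph on the remaining vertices), increase $k$, repeat. $\mathrm{cr}(v)$ is the rank of $v$; $\mathrm{cr}(G)$ is the maximum rank ($\infty$ largest). For $G$ of finite corner rank $\alpha\ge2$: $G$ is $1$-cop-win ($r=1$) if some (equivalently every) vertex of rank $\alpha$ is adjacent to all vertices of $G_{\alpha-1}$, otherwise $0$-cop-win ($r=0$). Projections: for each $k$ such that $G_{k+1}$ is defined, define $f_k$ from nonempty subsets of $V(G_k)$ to nonempty subsets of $V(G_{k+1})$ by $f_k(\{u\})=\{u\}$ if $\mathrm{cr}(u)>k$, and otherwise $f_k(\{u\})$ = the set of vertices of $G_{k+1}$ that strictly corner $u$ in $G_k$;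 and $f_k(S)=\bigcup_{u\in S}f_k(\{u\})$. Let $F_1$ be the identity and $F_k=f_{k-1}\circ\cdots\circ f_1$; write $F_k(v)=F_k(\{v\})$. Game: cop places, then robber places, then alternate moves with the cop first; a move is staying or moving to an adjacent vertex; cop wins on sharing a vertex. Capture time $\operatorname{capt}(G)$: minimum number of cop moves (placement not counted) guaranteeing a win. A cop strategy is optimal if it wins within $\operatorname{capt}(G)$ cop moves against every robber; a robber strategy is optimal if against every cop strategy the cop needs at least $\operatorname{capt}(G)$ moves. Cop strategies: the robber at $x$ is $0$-cornered by the cop at $c$ if $c=x$; for $k\ge1$, $x$ is $k$-cornered by $c$ if some $x'\in F_k(x)$ is cornered by $c$ in the subgraph induced by $V(G_k)\cup\{c\}$ (not necessarily strictly; $c=x'$ allowed). An initial cop placement is standard if the vertex is adjacent to every vertex of $G_{\alpha-r}$. A Lower Way strategy is a cop strategy with a standard initial placement such that for every $t\ge1$, after $t$ cop moves the cop $k$-corners the robber for some $k\le\alpha-r-t$. Robber strategies: with the cop at $c$, a vertex $x$ is $k$-proj-safe if $\mathrm{cr}(x)\ge k$ and some $c'\in F_k(c)$ is not adjacent to $x$. A Higher Way strategy: at every turn (including the initial placement) the robber goes to a $k$-proj-safe vertex with $k$ maximum; if none is available, he moves arbitrarily to a vertex not occupied by the cop. -}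

module Defs where

open import Data.Nat using (ℕ; zero; suc; _≤_; _<_; _∸_)
open import Data.Fin using (Fin; _≟_)
open import Data.Bool using (Bool; true; false; T; not; _∧_; _∨_; if_then_else_)
open import Data.List using (List; []; _∷_; allFin)
open import Data.Bool.ListAction using (all; any)
open import Data.Product using (Σ; _×_; _,_)
open import Data.Sum using (_⊎_)
open import Data.Unit using (⊤)
open import Relation.Nullary using (¬_; does)
open import Relation.Binary.PropositionalEquality using (_≡_; _≢_)

record Graph (n : ℕ) : Set where
  field
    adj     : Fin n → Fin n → Bool
    adj-refl : ∀ v → T (adj v v)
    adj-sym  : ∀ u v → adj u v ≡ adj v u
open Graph public

data ℕ∞ : Set where
  fin : ℕ → ℕ∞
  ∞   : ℕ∞

data _≤∞_ : ℕ∞ → ℕ∞ → Set where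
  fin≤fin : ∀ {a b} → a ≤ b → fin a ≤∞ fin b
  ≤∞-top  : ∀ {a} → a ≤∞ ∞

_<∞_ : ℕ∞ → ℕ∞ → Set
a <∞ b = (a ≤∞ b) × (a ≢ b)

-- A set of vertices (an induced subgraph) is a Boolean predicate.
VSet : ℕ → Set
VSet n = Fin n → Bool

module _ {n : ℕ} (G : Graph n) where

  allV : (Fin n → Bool) → Bool
  allV p = all p (allFin n)

  anyV : (Fin n → Bool) → Bool
  anyV p = any p (allFin n)

  full : VSet n
  full _ = true

  _∪｛_｝ : VSet n → Fin n → VSet n
  (S ∪｛ c ｝) v = S v ∨ does (v ≟ c)

  corners : VSet n → Fin n → Fin n → Bool
  corners S w v = allV (λ u → not (S u ∧ adj G u v) ∨ adj G u w)

  strictlyCorners : VSet n → Fin n → Fin n → Bool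
  strictlyCorners S w v =
    S w ∧ S v ∧ not (does (w ≟ v)) ∧ corners S w v
    ∧ anyV (λ u → S u ∧ adj G u w ∧ not (adj G u v))

  isStrictCorner : VSet n → Fin n → Bool
  isStrictCorner S v = anyV (λ w → strictlyCorners S w v)

  isClique : VSet n → Bool
  isClique S = allV (λ u → allV (λ v → not (S u ∧ S v) ∨ adj G u v))

  hasStrictCorner : VSet n → Bool
  hasStrictCorner S = anyV (isStrictCorner S)

  stops : VSet n → Bool
  stops S = isClique S ∨ not (hasStrictCorner S)

  next : VSet n → VSet n
  next S = if stops S then S else (λ v → S v ∧ not (isStrictCorner S v))

  -- 𝒢 k is G_k (k ≥ 1); 𝒢 0 is an unused junk value.
  𝒢 : ℕ → VSet n
  𝒢 zero = full
  𝒢 (suc zero) = full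
  𝒢 (suc (suc k)) = next (𝒢 (suc k))

  Running : ℕ → Set
  Running k = ∀ j → 1 ≤ j → j < k → ¬ T (stops (𝒢 j))

  CR : Fin n → ℕ∞ → Set
  CR v (fin k) =
    1 ≤ k × Running k × T (𝒢 k v) ×
    (T (isClique (𝒢 k)) ⊎ (¬ T (isClique (𝒢 k)) × T (isStrictCorner (𝒢 k) v)))
  CR v ∞ =
    Σ ℕ λ k → 1 ≤ k × Running k × T (𝒢 k v) ×
    ¬ T (isClique (𝒢 k)) × ¬ T (hasStrictCorner (𝒢 k))

  CornerRank : ℕ∞ → Set
  CornerRank ρ = (Σ (Fin n) λ v → CR v ρ) × (∀ v ρ' → CR v ρ' → ρ' ≤∞ ρ)

  crGreater : Fin n → ℕ → Set
  crGreater v k = Σ ℕ∞ λ ρ → CR v ρ × fin k <∞ ρ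

  crAtLeast : Fin n → ℕ → Set
  crAtLeast v k = Σ ℕ∞ λ ρ → CR v ρ × fin k ≤∞ ρ

  -- r-type: r = 1 iff some vertex of rank α is adjacent to all of G_{α-1}
  OneCopWinWitness : ℕ → Set
  OneCopWinWitness α =
    Σ (Fin n) λ v → CR v (fin α) × (∀ u → T (𝒢 (α ∸ 1) u) → T (adj G v u))

  CopWinType : ℕ → ℕ → Set
  CopWinType α r = (r ≡ 1 × OneCopWinWitness α) ⊎ (r ≡ 0 × ¬ OneCopWinWitness α)

  Proj : ℕ → Fin n → Fin n → Set
  Proj k u w =
    (crGreater u k × w ≡ u) ⊎
    (¬ crGreater u k × T (𝒢 (suc k) w) × T (strictlyCorners (𝒢 k) w u))

  data InF : ℕ → Fin n → Fin n → Set where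
    base : ∀ {v} → InF 1 v v
    step : ∀ {k v u w} → InF k v u → Proj k u w → InF (suc k) v w

  Cornered : ℕ → Fin n → Fin n → Set
  Cornered zero c x = c ≡ x
  Cornered (suc k) c x =
    Σ (Fin n) λ x' → InF (suc k) x x' ×
      (c ≡ x' ⊎ T (corners (𝒢 (suc k) ∪｛ c ｝) c x'))

  ProjSafe : ℕ → Fin n → Fin n → Set
  ProjSafe k c x = crAtLeast x k × (Σ (Fin n) λ c' → InF k c c' × adj G c' x ≡ false)

  -- A strategy maps the history of positions so far (most
  -- recent first: ..., c_t, r_{t-1}, c_{t-1}, ..., r_0, c_0 reversed) to
  -- the next position.  The cop's strategy is applied to histories of
  -- even length (the empty one gives the initial placement), the robber's
  -- to histories of odd length.

  Strategy : Set
  Strategy = List (Fin n) → Fin n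

  -- a move goes to a vertex adjacent to the mover's previous position,
  -- which is the second entry of the history
  Legal : Strategy → Set
  Legal s = ∀ x y h → T (adj G y (s (x ∷ y ∷ h)))

  module Play (σ τ : Strategy) where
    mutual
      histC : ℕ → List (Fin n)
      histC zero = []
      histC (suc t) = τ (histR t) ∷ histR t

      histR : ℕ → List (Fin n)
      histR t = σ (histC t) ∷ histC t

    cpos : ℕ → Fin n               -- c_t: cop after t moves (c_0 placement)
    cpos t = σ (histC t)

    rpos : ℕ → Fin n               -- r_t: robber after t moves (r_0 placement)
    rpos t = τ (histR t)

    -- the cop has won within m cop moves
    CaughtWithin : ℕ → Set
    CaughtWithin m = Σ ℕ λ t →
      (t ≤ m × rpos t ≡ cpos t) ⊎ (suc t ≤ m × cpos (suc t) ≡ rpos t)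

    FreeBeforeRobber : ℕ → Set
    FreeBeforeRobber t =
      (∀ s → s < t → rpos s ≢ cpos s) × (∀ s → suc s ≤ t → cpos (suc s) ≢ rpos s)

  open Play public

  WinsWithin : Strategy → ℕ → Set
  WinsWithin σ m = ∀ τ → Legal τ → CaughtWithin σ τ m

  Capt : ℕ → Set
  Capt m =
    (Σ Strategy λ σ → Legal σ × WinsWithin σ m) ×
    (∀ σ m' → Legal σ → WinsWithin σ m' → m ≤ m')

  OptimalCop : Strategy → Set
  OptimalCop σ = ∀ m → Capt m → WinsWithin σ m

  OptimalRobber : Strategy → Set
  OptimalRobber τ = ∀ m → Capt m → ∀ σ → Legal σ → ∀ m' → CaughtWithin σ τ m' → m ≤ m'

  LowerWay : ℕ → ℕ → Strategy → Set
  LowerWay α r σ =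
    (∀ v → T (𝒢 (α ∸ r) v) → T (adj G (σ []) v)) ×
    (∀ τ → Legal τ → ∀ t → 1 ≤ t → ¬ CaughtWithin σ τ (t ∸ 1) →
       Σ ℕ λ k → k ≤ α ∸ r ∸ t × Cornered k (cpos σ τ t) (rpos σ τ (t ∸ 1)))

  Reach : Strategy → Strategy → ℕ → Fin n → Set
  Reach σ τ zero x = ⊤
  Reach σ τ (suc t) x = T (adj G (rpos σ τ t) x)

  HigherWay : Strategy → Set
  HigherWay τ = ∀ σ → Legal σ → ∀ t → FreeBeforeRobber σ τ t →
    let c = cpos σ τ t
        y = rpos σ τ t
    in (Σ ℕ λ k → 1 ≤ k × ProjSafe k c y ×
          (∀ k' x' → 1 ≤ k' → Reach σ τ t x' → ProjSafe k' c x' → k' ≤ k))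
       ⊎ ((¬ (Σ ℕ λ k → Σ (Fin n) λ x → 1 ≤ k × Reach σ τ t x × ProjSafe k c x))
          × y ≢ c)

-- Both claims follow from capt(G) = K with K = α ∸ r.  The projections send adjacent
-- vertices to adjacent ones, because a removed strict corner is replaced by a vertex
-- cornering it.  Upper bound: from a standard start the cop can stand, after t + 1 moves,
-- on a vertex of F_{K-t}(r_t); since F_1 is the identity this catches the robber within K
-- moves.  Lower bound: G_{K-1} has no dominating vertex, so the robber can start non-adjacent to
-- a vertex of F_{K-1}(c_0), and he can keep such a position one level lower every round,
-- for otherwise the cop's projection would strictly corner him in a stage G_j he survives.
-- A Lower Way strategy 0-corners, i.e. catches, the robber after K moves, and a Higher Way
-- strategy always reaches a proj-safe position of maximal level, which is all the lower
-- bound uses.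

module Submission where

open import Defs
open import Data.Nat using (ℕ; zero; suc; _≤_; _<_; _∸_; z≤n; s≤s; _≤?_)
open import Data.Nat.Properties
  using (≤-refl; ≤-trans; <⇒≤; ≤-reflexive; ≤-antisym; <-irrefl; <-≤-trans; n≤1+n; m≤n⇒m≤1+n;
         m<1+n⇒m<n∨m≡n; m≤n⇒m<n∨m≡n; m<1+n⇒m≤n; ≤∧≢⇒<; ≰⇒>; m∸n≤m; ∸-monoʳ-<; ∸-monoˡ-≤;
         n∸n≡0; m∸[m∸n]≡n; n≮0)
open import Data.Nat.Induction using (<-wellFounded)
open import Induction.WellFounded using (Acc; acc)
open import Data.Fin using (Fin; _≟_)
open import Data.Fin.Properties using (any?; ¬∀⟶∃¬)
open import Data.Bool using (Bool; true; false; T; not; _∧_; _∨_; if_then_else_)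
open import Data.Bool.Properties using (T-∧; T-∨; T-not-≡)
open import Data.List using (List; []; _∷_; allFin)
open import Data.Bool.ListAction using (all; any)
import Data.List.Relation.Unary.All as All
import Data.List.Relation.Unary.Any as Any
open import Data.List.Relation.Unary.All.Properties using (all⁺; all⁻)
open import Data.List.Relation.Unary.Any.Properties using (any⁺; any⁻)
open import Data.List.Membership.Propositional using (_∈_)
open import Data.List.Membership.Propositional.Properties using (∈-allFin)
open import Data.List.Relation.Unary.Any using (here; there)
open import Data.Product using (∃; _×_; _,_; proj₁; proj₂)
open import Data.Sum using (inj₁; inj₂)
open import Data.Unit using (⊤; tt)
open import Data.Empty using (⊥; ⊥-elim)
open import Function using (_∘_; Equivalence)
open import Relation.Nullary using (¬_; does; yes; no; Dec; ¬?; _×-dec_; _→-dec_)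
open import Relation.Nullary.Decidable using (T?; decidable-stable)
open import Relation.Binary.PropositionalEquality using (_≡_; _≢_; refl; sym; trans; cong; subst)


∧-split : ∀ {a b} → T (a ∧ b) → T a × T b
∧-split = Equivalence.to T-∧

∧-join : ∀ {a b} → T a → T b → T (a ∧ b)
∧-join p q = Equivalence.from T-∧ (p , q)

not⁻ : ∀ {b} → T (not b) → ¬ T b
not⁻ {false} _ ()

not⁺ : ∀ {b} → ¬ T b → T (not b)
not⁺ {false} _ = tt
not⁺ {true} ¬t = ¬t tt

¬T⇒≡false : ∀ {b} → ¬ T b → b ≡ false
¬T⇒≡false = Equivalence.to T-not-≡ ∘ not⁺

≡false⇒¬T : ∀ {b} → b ≡ false → ¬ T b
≡false⇒¬T refl ()

implies⁻ : ∀ {a b} → T (not a ∨ b) → T a → T b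
implies⁻ {true} h _ = h

implies⁺ : ∀ {a b} → (T a → T b) → T (not a ∨ b)
implies⁺ {false} _ = tt
implies⁺ {true} f = f tt

module _ {n : ℕ} {p : Fin n → Bool} where

  all-allFin⁻ : T (all p (allFin n)) → ∀ v → T (p v)
  all-allFin⁻ h v = All.lookup (all⁺ p (allFin n) h) (∈-allFin v)

  all-allFin⁺ : (∀ v → T (p v)) → T (all p (allFin n))
  all-allFin⁺ f = all⁻ p {xs = allFin n} (All.tabulate (λ {v} _ → f v))

  any-allFin⁻ : T (any p (allFin n)) → ∃ (T ∘ p)
  any-allFin⁻ h = Any.satisfied (any⁻ p (allFin n) h)

  any-allFin⁺ : ∀ v → T (p v) → T (any p (allFin n))
  any-allFin⁺ v h = any⁺ {xs = allFin n} p (Any.map (λ { refl → h }) (∈-allFin v))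


count : ∀ {A : Set} → (A → Bool) → List A → ℕ
count p [] = 0
count p (x ∷ xs) = if p x then suc (count p xs) else count p xs

module _ {A : Set} (p q : A → Bool) (p⊆q : ∀ x → T (p x) → T (q x)) where

  count-mono : ∀ xs → count p xs ≤ count q xs
  count-mono [] = z≤n
  count-mono (x ∷ xs) with p x in px | q x in qx
  ... | true  | true  = s≤s (count-mono xs)
  ... | true  | false = ⊥-elim (subst T qx (p⊆q x (subst T (sym px) tt)))
  ... | false | true  = m≤n⇒m≤1+n (count-mono xs)
  ... | false | false = count-mono xs

  count-< : ∀ {xs y} → y ∈ xs → T (q y) → ¬ T (p y) → count p xs < count q xs
  count-< {x ∷ xs} (here refl) qy ¬py with p x | q x
  ... | true  | _     = ⊥-elim (¬py tt)
  ... | false | true  = s≤s (count-mono xs)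
  ... | false | false = ⊥-elim qy
  count-< {x ∷ xs} (there y∈xs) qy ¬py with p x in px | q x in qx
  ... | true  | true  = s≤s (count-< y∈xs qy ¬py)
  ... | true  | false = ⊥-elim (subst T qx (p⊆q x (subst T (sym px) tt)))
  ... | false | true  = m≤n⇒m≤1+n (count-< y∈xs qy ¬py)
  ... | false | false = count-< y∈xs qy ¬py

module Cornering {n : ℕ} (G : Graph n) where

  Adj : Fin n → Fin n → Set
  Adj u v = T (adj G u v)

  Adj-sym : ∀ {u v} → Adj u v → Adj v u
  Adj-sym {u} {v} = subst T (adj-sym G u v)

  Adj-refl : ∀ v → Adj v v
  Adj-refl = adj-refl G

  Adj? : ∀ u v → Dec (Adj u v)
  Adj? u v = T? (adj G u v)

  Corners : VSet n → Fin n → Fin n → Set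
  Corners S w v = ∀ u → T (S u) → Adj u v → Adj u w

  corners⁻ : ∀ {S w v} → T (corners G S w v) → Corners S w v
  corners⁻ {S} h u u∈S uv = implies⁻ {S u ∧ _} (all-allFin⁻ h u) (∧-join u∈S uv)

  corners⁺ : ∀ {S w v} → Corners S w v → T (corners G S w v)
  corners⁺ {S} c = all-allFin⁺ λ u → implies⁺ {S u ∧ _} λ h →
    let (u∈S , uv) = ∧-split h in c u u∈S uv

  record StrictlyCorners (S : VSet n) (w v : Fin n) : Set where
    field
      cornerer∈     : T (S w)
      cornered∈     : T (S v)
      distinct      : w ≢ v
      nbhd⊆         : Corners S w v
      witness       : Fin n
      witness∈      : T (S witness)
      witness-adj   : Adj witness w
      witness-¬adj  : ¬ Adj witness v
  open StrictlyCorners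

  ≢⁻ : ∀ {w v : Fin n} → T (not (does (w ≟ v))) → w ≢ v
  ≢⁻ {w} {v} h with w ≟ v
  ... | no w≢v = w≢v

  ≢⁺ : ∀ {w v : Fin n} → w ≢ v → T (not (does (w ≟ v)))
  ≢⁺ {w} {v} w≢v with w ≟ v
  ... | yes w≡v = w≢v w≡v
  ... | no _ = tt

  strictlyCorners⁻ : ∀ {S w v} → T (strictlyCorners G S w v) → StrictlyCorners S w v
  strictlyCorners⁻ {S} {w} {v} h =
    let (w∈S , h₁) = ∧-split {S w} h
        (v∈S , h₂) = ∧-split {S v} h₁
        (w≢v , h₃) = ∧-split {not (does (w ≟ v))} h₂
        (wv , h₄) = ∧-split {corners G S w v} h₃
        (u , hu) = any-allFin⁻ h₄
        (u∈S , h₅) = ∧-split {S u} hu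
        (uw , ¬uv) = ∧-split {adj G u w} h₅
    in record { cornerer∈ = w∈S ; cornered∈ = v∈S ; distinct = ≢⁻ w≢v ; nbhd⊆ = corners⁻ wv
              ; witness = u ; witness∈ = u∈S ; witness-adj = uw ; witness-¬adj = not⁻ ¬uv }

  strictlyCorners⁺ : ∀ {S w v} → StrictlyCorners S w v → T (strictlyCorners G S w v)
  strictlyCorners⁺ sc =
    ∧-join (cornerer∈ sc) (∧-join (cornered∈ sc) (∧-join (≢⁺ (distinct sc))
      (∧-join (corners⁺ (nbhd⊆ sc)) (any-allFin⁺ (witness sc)
        (∧-join (witness∈ sc) (∧-join (witness-adj sc) (not⁺ (witness-¬adj sc))))))))

  isStrictCorner⁻ : ∀ {S v} → T (isStrictCorner G S v) → ∃ λ w → StrictlyCorners S w v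
  isStrictCorner⁻ h = let (w , sc) = any-allFin⁻ h in w , strictlyCorners⁻ sc

  isStrictCorner⁺ : ∀ {S v w} → StrictlyCorners S w v → T (isStrictCorner G S v)
  isStrictCorner⁺ {w = w} sc = any-allFin⁺ w (strictlyCorners⁺ sc)

  IsClique : VSet n → Set
  IsClique S = ∀ u v → T (S u) → T (S v) → Adj u v

  isClique⁻ : ∀ {S} → T (isClique G S) → IsClique S
  isClique⁻ {S} h u v u∈S v∈S =
    implies⁻ {S u ∧ S v} (all-allFin⁻ (all-allFin⁻ h u) v) (∧-join u∈S v∈S)

  isClique⁺ : ∀ {S} → IsClique S → T (isClique G S)
  isClique⁺ {S} c = all-allFin⁺ λ u → all-allFin⁺ λ v →
    implies⁺ {S u ∧ S v} λ h → let (u∈S , v∈S) = ∧-split h in c u v u∈S v∈S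

  StrictlyCorners-trans : ∀ {S x y z} →
    StrictlyCorners S x y → StrictlyCorners S y z → StrictlyCorners S x z
  StrictlyCorners-trans xy yz = record
    { cornerer∈ = cornerer∈ xy ; cornered∈ = cornered∈ yz
    ; distinct = λ { refl → witness-¬adj xy (nbhd⊆ yz _ (witness∈ xy) (witness-adj xy)) }
    ; nbhd⊆ = λ u u∈S uz → nbhd⊆ xy u u∈S (nbhd⊆ yz u u∈S uz)
    ; witness = witness yz ; witness∈ = witness∈ yz
    ; witness-adj = nbhd⊆ xy _ (witness∈ yz) (witness-adj yz) ; witness-¬adj = witness-¬adj yz }

  dominates⇒¬isStrictCorner : ∀ {S w} → (∀ u → T (S u) → Adj w u) → ¬ T (isStrictCorner G S w)
  dominates⇒¬isStrictCorner {S} dominates is =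
    let (_ , sc) = isStrictCorner⁻ {S} is
    in witness-¬adj sc (Adj-sym (dominates (witness sc) (witness∈ sc)))

  ∣_∣ : VSet n → ℕ
  ∣ S ∣ = count S (allFin n)

  degree : VSet n → Fin n → ℕ
  degree S v = ∣ (λ u → S u ∧ adj G u v) ∣

  degree-< : ∀ {S w v} → StrictlyCorners S w v → degree S v < degree S w
  degree-< {S} sc = count-< _ _ neighbour⊆ (∈-allFin (witness sc))
    (∧-join (witness∈ sc) (witness-adj sc)) (witness-¬adj sc ∘ proj₂ ∘ ∧-split {S (witness sc)})
    where
    neighbour⊆ : ∀ u → T (S u ∧ _) → T (S u ∧ _)
    neighbour⊆ u h = let (u∈S , uv) = ∧-split {S u} h in ∧-join u∈S (nbhd⊆ sc u u∈S uv)

  degree≤ : ∀ S v → degree S v ≤ ∣ full G ∣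
  degree≤ S v = count-mono _ _ (λ _ _ → tt) (allFin n)

  strictlyCorneredByNonCorner : ∀ {S v} → T (isStrictCorner G S v) →
    ∃ λ w → StrictlyCorners S w v × ¬ T (isStrictCorner G S w)
  strictlyCorneredByNonCorner {S} {v} = go v (<-wellFounded _)
    where
    go : ∀ v → Acc _<_ (∣ full G ∣ ∸ degree S v) → T (isStrictCorner G S v) →
      ∃ λ w → StrictlyCorners S w v × ¬ T (isStrictCorner G S w)
    go v (acc rs) is with isStrictCorner⁻ is
    ... | w , wv with T? (isStrictCorner G S w)
    ...   | no ¬is = w , wv , ¬is
    ...   | yes isw =
      let (w' , w'w , ¬is) = go w (rs (∸-monoʳ-< (degree-< wv) (degree≤ S w))) isw
      in w' , StrictlyCorners-trans w'w wv , ¬is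

∸-suc : ∀ {m n} → n < m → m ∸ n ≡ suc (m ∸ suc n)
∸-suc {suc m} {zero} _ = refl
∸-suc {suc m} {suc n} (s≤s n<m) = ∸-suc n<m

suc-∸1 : ∀ {m} → 1 ≤ m → suc (m ∸ 1) ≡ m
suc-∸1 1≤m = sym (∸-suc 1≤m)

≤∞-pred : ∀ {k ρ} → fin (suc k) ≤∞ ρ → fin k ≤∞ ρ
≤∞-pred (fin≤fin k<j) = fin≤fin (<⇒≤ k<j)
≤∞-pred ≤∞-top = ≤∞-top

module Stages {n : ℕ} (G : Graph n) where
  open Cornering G

  In : ℕ → Fin n → Set
  In k v = T (𝒢 G k v)

  Dominating : ℕ → Fin n → Set
  Dominating L w = ∀ u → In L u → Adj w u

  ¬Dominating⇒nonNeighbour : ∀ {L w} → ¬ Dominating L w → ∃ λ x → In L x × ¬ Adj w x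
  ¬Dominating⇒nonNeighbour {L} {w} ¬dom
    with ¬∀⟶∃¬ n _ (λ x → T? (𝒢 G L x) →-dec Adj? w x) ¬dom
  ... | x , ¬[x∈⇒wx] with T? (𝒢 G L x)
  ...   | yes x∈ = x , x∈ , λ wx → ¬[x∈⇒wx] (λ _ → wx)
  ...   | no x∉ = ⊥-elim (¬[x∈⇒wx] (⊥-elim ∘ x∉))

  ¬stops : ∀ {S} → ¬ T (isClique G S) → T (hasStrictCorner G S) → ¬ T (stops G S)
  ¬stops {S} ¬cl hsc st with isClique G S
  ... | true = ¬cl tt
  ... | false = not⁻ st hsc

  isClique⇒stops : ∀ {S} → IsClique S → T (stops G S)
  isClique⇒stops {S} cl = Equivalence.from (T-∨ {isClique G S}) (inj₁ (isClique⁺ cl))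

  ¬stops⇒hasStrictCorner : ∀ {S} → ¬ T (stops G S) → T (hasStrictCorner G S)
  ¬stops⇒hasStrictCorner {S} ¬st with hasStrictCorner G S
  ... | true = tt
  ... | false = ¬st (Equivalence.from T-∨ (inj₂ tt))

  next⊆ : ∀ {S v} → T (next G S v) → T (S v)
  next⊆ {S} {v} h with stops G S
  ... | true = h
  ... | false = proj₁ (∧-split {S v} h)

  next-removes : ∀ {S v} → ¬ T (stops G S) → T (next G S v) → ¬ T (isStrictCorner G S v)
  next-removes {S} {v} ¬st h with stops G S
  ... | true = ⊥-elim (¬st tt)
  ... | false = not⁻ (proj₂ (∧-split {S v} h))

  next-keeps : ∀ {S v} → ¬ T (stops G S) → T (S v) → ¬ T (isStrictCorner G S v) → T (next G S v)
  next-keeps {S} {v} ¬st v∈S ¬is with stops G S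
  ... | true = ⊥-elim (¬st tt)
  ... | false = ∧-join v∈S (not⁺ ¬is)

  𝒢-suc⊆ : ∀ {k v} → In (suc k) v → In k v
  𝒢-suc⊆ {zero} v∈ = v∈
  𝒢-suc⊆ {suc k} v∈ = next⊆ v∈

  𝒢-anti-mono : ∀ {j k v} → j ≤ k → In k v → In j v
  𝒢-anti-mono {k = zero} z≤n v∈ = v∈
  𝒢-anti-mono {k = suc k} j≤1+k v∈ with m≤n⇒m<n∨m≡n j≤1+k
  ... | inj₁ j<1+k = 𝒢-anti-mono (m<1+n⇒m≤n j<1+k) (𝒢-suc⊆ {k} v∈)
  ... | inj₂ refl = v∈

  𝒢-suc-removes : ∀ {k v} → 1 ≤ k → ¬ T (stops G (𝒢 G k)) →
    In (suc k) v → ¬ T (isStrictCorner G (𝒢 G k) v)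
  𝒢-suc-removes {suc k} _ = next-removes

  𝒢-suc-keeps : ∀ {k v} → 1 ≤ k → ¬ T (stops G (𝒢 G k)) →
    In k v → ¬ T (isStrictCorner G (𝒢 G k) v) → In (suc k) v
  𝒢-suc-keeps {suc k} _ = next-keeps

  ∣𝒢-suc∣< : ∀ {k} → 1 ≤ k → ¬ T (stops G (𝒢 G k)) → ∣ 𝒢 G (suc k) ∣ < ∣ 𝒢 G k ∣
  ∣𝒢-suc∣< {k} 1≤k ¬st =
    let (u , is) = any-allFin⁻ {p = isStrictCorner G (𝒢 G k)} (¬stops⇒hasStrictCorner {𝒢 G k} ¬st)
        (_ , sc) = isStrictCorner⁻ {𝒢 G k} is
    in count-< _ _ (λ _ → 𝒢-suc⊆ {k}) (∈-allFin u) (StrictlyCorners.cornered∈ sc)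
         (λ u∈ → 𝒢-suc-removes 1≤k ¬st u∈ is)

  Running-suc : ∀ {k} → Running G k → ¬ T (stops G (𝒢 G k)) → Running G (suc k)
  Running-suc run ¬st j 1≤j j<1+k with m<1+n⇒m<n∨m≡n j<1+k
  ... | inj₁ j<k = run j 1≤j j<k
  ... | inj₂ refl = ¬st

  Running-≤ : ∀ {j k} → j ≤ k → Running G k → Running G j
  Running-≤ j≤k run i 1≤i i<j = run i 1≤i (<-≤-trans i<j j≤k)

  rank-exists : ∀ {k v} → 1 ≤ k → Running G k → In k v → ∃ λ ρ → CR G v ρ × fin k ≤∞ ρ
  rank-exists {k} {v} = go k (<-wellFounded _)
    where
    go : ∀ k → Acc _<_ ∣ 𝒢 G k ∣ → 1 ≤ k → Running G k → In k v →
      ∃ λ ρ → CR G v ρ × fin k ≤∞ ρ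
    go k (acc rs) 1≤k run v∈ with T? (isClique G (𝒢 G k))
    ... | yes cl = fin k , (1≤k , run , v∈ , inj₁ cl) , fin≤fin ≤-refl
    ... | no ¬cl with T? (hasStrictCorner G (𝒢 G k))
    ...   | no ¬hsc = ∞ , (k , 1≤k , run , v∈ , ¬cl , ¬hsc) , ≤∞-top
    ...   | yes hsc with T? (isStrictCorner G (𝒢 G k) v)
    ...     | yes is = fin k , (1≤k , run , v∈ , inj₂ (¬cl , is)) , fin≤fin ≤-refl
    ...     | no ¬is =
      let ¬st = ¬stops {𝒢 G k} ¬cl hsc
          (ρ , cr , k+1≤ρ) = go (suc k) (rs (∣𝒢-suc∣< 1≤k ¬st)) (s≤s z≤n) (Running-suc run ¬st)
                               (𝒢-suc-keeps 1≤k ¬st v∈ ¬is)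
      in ρ , cr , ≤∞-pred k+1≤ρ

module Ranked {n : ℕ} (G : Graph n) (α : ℕ) (2≤α : 2 ≤ α) (rankG : CornerRank G (fin α)) where
  open Cornering G public
  open Stages G public
  open StrictlyCorners

  v₀ : Fin n
  v₀ = proj₁ (proj₁ rankG)

  v₀-rank : CR G v₀ (fin α)
  v₀-rank = proj₂ (proj₁ rankG)

  1≤α : 1 ≤ α
  1≤α = ≤-trans (s≤s z≤n) 2≤α

  running : Running G α
  running = proj₁ (proj₂ v₀-rank)

  rank : ∀ {k v} → 1 ≤ k → k ≤ α → In k v → ∃ λ ρ → CR G v ρ × fin k ≤∞ ρ
  rank 1≤k k≤α = rank-exists 1≤k (Running-≤ k≤α running)

  rank-finite : ∀ {v ρ} → CR G v ρ → ∃ λ j → ρ ≡ fin j × j ≤ α × In j v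
  rank-finite {v} {fin j} cr with proj₂ rankG v (fin j) cr
  ... | fin≤fin j≤α = j , refl , j≤α , proj₁ (proj₂ (proj₂ cr))
  rank-finite {v} {∞} cr with proj₂ rankG v ∞ cr
  ... | ()

  𝒢α-isClique : IsClique (𝒢 G α)
  𝒢α-isClique with proj₂ (proj₂ (proj₂ v₀-rank))
  ... | inj₁ cl = isClique⁻ cl
  ... | inj₂ (¬cl , is) =
    let (w , wv₀ , ¬isw) = strictlyCorneredByNonCorner {𝒢 G α} is
        ¬st = ¬stops {𝒢 G α} ¬cl (any-allFin⁺ v₀ is)
        (ρ , cr , α<ρ) = rank-exists (s≤s z≤n) (Running-suc running ¬st)
                           (𝒢-suc-keeps 1≤α ¬st (cornerer∈ wv₀) ¬isw)
    in ⊥-elim (α≮ρ α<ρ (proj₂ rankG w ρ cr))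
    where
    α≮ρ : ∀ {ρ} → fin (suc α) ≤∞ ρ → ρ ≤∞ fin α → ⊥
    α≮ρ (fin≤fin α<j) (fin≤fin j≤α) = <-irrefl refl (≤-trans α<j j≤α)

  crGreater⇒ : ∀ {u k} → crGreater G u k → In (suc k) u
  crGreater⇒ (ρ , cr , k≤ρ , k≢ρ) with rank-finite cr | k≤ρ
  ... | j , refl , _ , u∈ | fin≤fin k≤j = 𝒢-anti-mono (≤∧≢⇒< k≤j (k≢ρ ∘ cong fin)) u∈

  crGreater⇐ : ∀ {u k} → 1 ≤ k → suc k ≤ α → In (suc k) u → crGreater G u k
  crGreater⇐ 1≤k k<α u∈ =
    let (ρ , cr , k<ρ) = rank (s≤s z≤n) k<α u∈ in ρ , cr , ≤∞-pred k<ρ , k≢ρ k<ρ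
    where
    k≢ρ : ∀ {k ρ} → fin (suc k) ≤∞ ρ → fin k ≢ ρ
    k≢ρ (fin≤fin k<k) refl = <-irrefl refl k<k

  crAtLeast⇒ : ∀ {x k} → crAtLeast G x k → In k x × k ≤ α
  crAtLeast⇒ (ρ , cr , k≤ρ) with rank-finite cr | k≤ρ
  ... | j , refl , j≤α , x∈ | fin≤fin k≤j = 𝒢-anti-mono k≤j x∈ , ≤-trans k≤j j≤α

  crAtLeast⇐ : ∀ {x k} → 1 ≤ k → k ≤ α → In k x → crAtLeast G x k
  crAtLeast⇐ = rank

  ¬stops-below : ∀ {j} → 1 ≤ j → j < α → ¬ T (stops G (𝒢 G j))
  ¬stops-below = running _

  rank-α : ∀ {w} → In α w → CR G w (fin α)
  rank-α w∈ with rank 1≤α ≤-refl w∈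
  ... | ρ , cr , α≤ρ with rank-finite cr | α≤ρ
  ...   | j , refl , j≤α , _ | fin≤fin α≤j with ≤-antisym α≤j j≤α
  ...     | refl = cr

  Proj-adj : ∀ {k u w z} → Proj G k u w → In k z → Adj u z → Adj w z
  Proj-adj (inj₁ (_ , refl)) _ uz = uz
  Proj-adj {k} (inj₂ (_ , _ , wu)) z∈ uz =
    Adj-sym (nbhd⊆ (strictlyCorners⁻ {𝒢 G k} wu) _ z∈ (Adj-sym uz))

  InF-∈ : ∀ {k v w} → InF G k v w → In k w
  InF-∈ base = tt
  InF-∈ (step _ (inj₁ (cr , refl))) = crGreater⇒ cr
  InF-∈ (step _ (inj₂ (_ , w∈ , _))) = w∈

  InF-adj : ∀ {k x y x' y'} → Adj x y → InF G k x x' → InF G k y y' → Adj x' y'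
  InF-adj xy base base = xy
  InF-adj xy base (step () _)
  InF-adj xy (step () _) base
  InF-adj {suc k} xy (step px qx) (step py qy) =
    Adj-sym (Proj-adj qy (𝒢-suc⊆ {k} (InF-∈ (step px qx)))
              (Adj-sym (Proj-adj qx (InF-∈ py) (InF-adj xy px py))))

  InF-step-adj : ∀ {j x y c d} → InF G (suc j) x c → Adj x y → InF G j y d → Adj c d
  InF-step-adj (step px q) xy pd = Proj-adj q (InF-∈ pd) (InF-adj xy px pd)

  InF-refl : ∀ {k v} → 1 ≤ k → k ≤ α → In k v → InF G k v v
  InF-refl {suc zero} _ _ _ = base
  InF-refl {suc (suc k)} _ k<α v∈ =
    step (InF-refl (s≤s z≤n) (<⇒≤ k<α) (𝒢-suc⊆ {suc k} v∈))
         (inj₁ (crGreater⇐ (s≤s z≤n) k<α v∈ , refl))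

  ¬adj-InF : ∀ {k c c' x} → 1 ≤ k → k ≤ α → In k x → InF G k c c' → ¬ Adj c' x → ¬ Adj c x
  ¬adj-InF 1≤k k≤α x∈ pc ¬c'x cx = ¬c'x (InF-adj cx pc (InF-refl 1≤k k≤α x∈))

  InF-¬adj-pred : ∀ {j c c' x} → 1 ≤ j → InF G (suc j) c c' → In j x → ¬ Adj c' x →
    ∃ λ c'' → InF G j c c'' × ¬ Adj c'' x
  InF-¬adj-pred _ (step {u = u} pc q) x∈ ¬c'x = u , pc , ¬c'x ∘ Proj-adj q x∈

  InF-¬adj-lower : ∀ {L k c c' x} → 1 ≤ L → L ≤ k → In k x → InF G k c c' → ¬ Adj c' x →
    ∃ λ c'' → InF G L c c'' × ¬ Adj c'' x
  InF-¬adj-lower {k = suc k} 1≤L L≤1+k x∈ pc ¬c'x with m≤n⇒m<n∨m≡n L≤1+k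
  ... | inj₂ refl = _ , pc , ¬c'x
  ... | inj₁ L<1+k =
    let L≤k = m<1+n⇒m≤n L<1+k
        (_ , pc' , ¬c''x) = InF-¬adj-pred (≤-trans 1≤L L≤k) pc (𝒢-suc⊆ {k} x∈) ¬c'x
    in InF-¬adj-lower 1≤L L≤k (𝒢-suc⊆ {k} x∈) pc' ¬c''x

  nonCornerCornerer : VSet n → Fin n → Fin n
  nonCornerCornerer S u with T? (isStrictCorner G S u)
  ... | yes is = proj₁ (strictlyCorneredByNonCorner {S} is)
  ... | no _ = u

  nonCornerCornerer-spec : ∀ {S u} → T (isStrictCorner G S u) →
    StrictlyCorners S (nonCornerCornerer S u) u × ¬ T (isStrictCorner G S (nonCornerCornerer S u))
  nonCornerCornerer-spec {S} {u} is with T? (isStrictCorner G S u)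
  ... | yes is' = proj₂ (strictlyCorneredByNonCorner {S} is')
  ... | no ¬is = ⊥-elim (¬is is)

  projStep : ℕ → Fin n → Fin n
  projStep k u = if 𝒢 G (suc k) u then u else nonCornerCornerer (𝒢 G k) u

  -- proj 0 is junk; proj 1 v reduces to v because 𝒢 G 1 is full.
  proj : ℕ → Fin n → Fin n
  proj zero v = v
  proj (suc k) v = projStep k (proj k v)

  projStep-Proj : ∀ {k u} → 1 ≤ k → suc k ≤ α → In k u → Proj G k u (projStep k u)
  projStep-Proj {k} {u} 1≤k k<α u∈ with 𝒢 G (suc k) u in eq
  ... | true = inj₁ (crGreater⇐ 1≤k k<α (subst T (sym eq) tt) , refl)
  ... | false =
    let ¬st = ¬stops-below 1≤k k<α
        u∉ : ¬ In (suc k) u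
        u∉ = subst T eq
        is : T (isStrictCorner G (𝒢 G k) u)
        is = decidable-stable (T? _) (u∉ ∘ 𝒢-suc-keeps 1≤k ¬st u∈)
        (wu , ¬isw) = nonCornerCornerer-spec {𝒢 G k} is
    in inj₂ (u∉ ∘ crGreater⇒ , 𝒢-suc-keeps 1≤k ¬st (cornerer∈ wu) ¬isw , strictlyCorners⁺ wu)

  proj-InF : ∀ {k} v → 1 ≤ k → k ≤ α → InF G k v (proj k v)
  proj-InF {suc zero} v _ _ = base
  proj-InF {suc (suc k)} v _ k<α =
    let pv = proj-InF {suc k} v (s≤s z≤n) (<⇒≤ k<α)
    in step pv (projStep-Proj (s≤s z≤n) k<α (InF-∈ pv))

  -- If x had no such neighbour, d' would strictly corner x in G_j (with witness the
  -- predecessor of c'), contradicting x ∈ G_{j+1}.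
  escape : ∀ {j c d x c' d'} → 1 ≤ j → suc j ≤ α → Adj c d → In (suc j) x →
    InF G (suc j) c c' → ¬ Adj c' x → InF G j d d' → ∃ λ y → Adj x y × In j y × ¬ Adj d' y
  escape {j} {x = x} {d' = d'} 1≤j j<α cd x∈ (step {u = c''} pc q) ¬c'x pd
    with any? (λ y → Adj? x y ×-dec (T? (𝒢 G j y) ×-dec ¬? (Adj? d' y)))
  ... | yes (y , xy , y∈ , ¬d'y) = y , xy , y∈ , ¬d'y
  ... | no none = ⊥-elim (¬c'x (Proj-adj q (𝒢-suc⊆ {j} x∈) c''x))
    where
    d'-corners-x : Corners (𝒢 G j) d' x
    d'-corners-x u u∈ ux with Adj? d' u
    ... | yes d'u = Adj-sym d'u
    ... | no ¬d'u = ⊥-elim (none (u , Adj-sym ux , u∈ , ¬d'u))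
    c''d' : Adj c'' d'
    c''d' = InF-adj cd pc pd
    c''x : Adj c'' x
    c''x with x ≟ d' | Adj? c'' x
    ... | yes refl | _ = c''d'
    ... | no _ | yes c''x = c''x
    ... | no x≢d' | no ¬c''x =
      ⊥-elim (𝒢-suc-removes 1≤j (¬stops-below 1≤j j<α) x∈ (isStrictCorner⁺ d'x))
      where
      d'x : StrictlyCorners (𝒢 G j) d' x
      d'x = record
        { cornerer∈ = InF-∈ pd ; cornered∈ = 𝒢-suc⊆ {j} x∈ ; distinct = x≢d' ∘ sym
        ; nbhd⊆ = d'-corners-x ; witness = c'' ; witness∈ = InF-∈ pc
        ; witness-adj = c''d' ; witness-¬adj = ¬c''x }

  dominating⇒𝒢-suc-isClique : ∀ {L w} → 1 ≤ L → L < α → In L w → Dominating L w →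
    IsClique (𝒢 G (suc L))
  dominating⇒𝒢-suc-isClique {L} {w} 1≤L L<α w∈ dom u v u∈ v∈ with Adj? u v | u ≟ w
  ... | yes uv | _ = uv
  ... | no ¬uv | yes refl = ⊥-elim (¬uv (dom v (𝒢-suc⊆ {L} v∈)))
  ... | no ¬uv | no u≢w =
    ⊥-elim (𝒢-suc-removes 1≤L (¬stops-below 1≤L L<α) u∈ (isStrictCorner⁺ wu))
    where
    wu : StrictlyCorners (𝒢 G L) w u
    wu = record
      { cornerer∈ = w∈ ; cornered∈ = 𝒢-suc⊆ {L} u∈ ; distinct = u≢w ∘ sym
      ; nbhd⊆ = λ z z∈ _ → Adj-sym (dom z z∈) ; witness = v ; witness∈ = 𝒢-suc⊆ {L} v∈
      ; witness-adj = Adj-sym (dom v (𝒢-suc⊆ {L} v∈)) ; witness-¬adj = ¬uv ∘ Adj-sym }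

  ProjSafe⇒¬adj : ∀ {k c x} → 1 ≤ k → ProjSafe G k c x → ¬ Adj c x
  ProjSafe⇒¬adj 1≤k (atLeast , _ , pc , c'x≡false) =
    let (x∈ , k≤α) = crAtLeast⇒ atLeast in ¬adj-InF 1≤k k≤α x∈ pc (≡false⇒¬T c'x≡false)

  ProjSafe-proj : ∀ {L c x} → 1 ≤ L → L ≤ α → In L x → ¬ Adj (proj L c) x → ProjSafe G L c x
  ProjSafe-proj {L} {c} 1≤L L≤α x∈ ¬adj =
    crAtLeast⇐ 1≤L L≤α x∈ , proj L c , proj-InF c 1≤L L≤α , ¬T⇒≡false ¬adj

  another-vertex : ∀ c → ∃ λ x → x ≢ c
  another-vertex c = ¬∀⟶∃¬ n _ (_≟ c) λ all≡c →
    ¬stops-below ≤-refl 2≤α (isClique⇒stops {𝒢 G 1} λ u v _ _ →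
      subst (Adj u) (trans (all≡c u) (sym (all≡c v))) (Adj-refl u))

  ¬dominating-below : ∀ {L w} → 1 ≤ L → suc L < α → In L w → ¬ Dominating L w
  ¬dominating-below 1≤L L+1<α w∈ dom =
    ¬stops-below (s≤s z≤n) L+1<α
      (isClique⇒stops (dominating⇒𝒢-suc-isClique 1≤L (<⇒≤ L+1<α) w∈ dom))

  ¬dominating-α-1 : ¬ OneCopWinWitness G α → ∀ {w} → In (α ∸ 1) w → ¬ Dominating (α ∸ 1) w
  ¬dominating-α-1 ¬witness {w} w∈ dom =
    ¬witness (w , rank-α (subst (λ k → In k w) α-1+1≡α w∈α) , dom)
    where
    α-1+1≡α : suc (α ∸ 1) ≡ α
    α-1+1≡α = suc-∸1 1≤α
    1≤α-1 : 1 ≤ α ∸ 1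
    1≤α-1 = ∸-monoˡ-≤ 1 2≤α
    w∈α : In (suc (α ∸ 1)) w
    w∈α = 𝒢-suc-keeps 1≤α-1 (¬stops-below 1≤α-1 (≤-reflexive α-1+1≡α)) w∈
            (dominates⇒¬isStrictCorner {𝒢 G (α ∸ 1)} dom)

  record CopWinLevel (K : ℕ) : Set where
    field
      1≤K           : 1 ≤ K
      c₀            : Fin n
      c₀-standard   : Dominating K c₀
      no-dominating : 1 ≤ K ∸ 1 → ∀ {w} → In (K ∸ 1) w → ¬ Dominating (K ∸ 1) w

  copWinLevel : ∀ {r} → CopWinType G α r → CopWinLevel (α ∸ r)
  copWinLevel (inj₁ (refl , w , _ , w-dominating)) = record
    { 1≤K = 1≤α-1 ; c₀ = w ; c₀-standard = w-dominating
    ; no-dominating = λ 1≤L → ¬dominating-below 1≤L α-2+2≤α }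
    where
    1≤α-1 : 1 ≤ α ∸ 1
    1≤α-1 = ∸-monoˡ-≤ 1 2≤α
    α-2+2≤α : suc (suc (α ∸ 1 ∸ 1)) ≤ α
    α-2+2≤α = ≤-reflexive (trans (cong suc (suc-∸1 1≤α-1)) (suc-∸1 1≤α))
  copWinLevel (inj₂ (refl , ¬witness)) = record
    { 1≤K = 1≤α ; c₀ = v₀
    ; c₀-standard = λ u u∈ → 𝒢α-isClique v₀ u (proj₁ (proj₂ (proj₂ v₀-rank))) u∈
    ; no-dominating = λ _ → ¬dominating-α-1 ¬witness }

rounds : ∀ {A : Set} → List A → ℕ
rounds (_ ∷ _ ∷ h) = suc (rounds h)
rounds _ = 0

module Capture {n : ℕ} (G : Graph n) (σ τ : Strategy G) where

  rounds-histC : ∀ t → rounds (histC G σ τ t) ≡ t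
  rounds-histC zero = refl
  rounds-histC (suc t) = cong suc (rounds-histC t)

  CaughtWithin-mono : ∀ {m m'} → m ≤ m' → CaughtWithin G σ τ m → CaughtWithin G σ τ m'
  CaughtWithin-mono m≤m' (t , inj₁ (t≤m , eq)) = t , inj₁ (≤-trans t≤m m≤m' , eq)
  CaughtWithin-mono m≤m' (t , inj₂ (t<m , eq)) = t , inj₂ (≤-trans t<m m≤m' , eq)

  FreeBeforeRobber-suc : ∀ {t} → FreeBeforeRobber G σ τ t → rpos G σ τ t ≢ cpos G σ τ t →
    cpos G σ τ (suc t) ≢ rpos G σ τ t → FreeBeforeRobber G σ τ (suc t)
  FreeBeforeRobber-suc {t} (apart , unmet) r≢c c'≢r = apart' , unmet'
    where
    apart' : ∀ s → s < suc t → rpos G σ τ s ≢ cpos G σ τ s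
    apart' s s<1+t with m<1+n⇒m<n∨m≡n s<1+t
    ... | inj₁ s<t = apart s s<t
    ... | inj₂ refl = r≢c
    unmet' : ∀ s → suc s ≤ suc t → cpos G σ τ (suc s) ≢ rpos G σ τ s
    unmet' s (s≤s s≤t) with m≤n⇒m<n∨m≡n s≤t
    ... | inj₁ s<t = unmet s s<t
    ... | inj₂ refl = c'≢r

  CaughtWithin? : ∀ m → Dec (CaughtWithin G σ τ m)
  CaughtWithin? zero with rpos G σ τ zero ≟ cpos G σ τ zero
  ... | yes eq = yes (zero , inj₁ (z≤n , eq))
  ... | no neq = no λ { (zero , inj₁ (z≤n , eq)) → neq eq ; (_ , inj₂ (() , _)) }
  CaughtWithin? (suc m) with CaughtWithin? m
  ... | yes caught = yes (CaughtWithin-mono (n≤1+n m) caught)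
  ... | no ¬caught with rpos G σ τ (suc m) ≟ cpos G σ τ (suc m) | cpos G σ τ (suc m) ≟ rpos G σ τ m
  ...   | yes eq | _ = yes (suc m , inj₁ (≤-refl , eq))
  ...   | no _ | yes eq = yes (m , inj₂ (≤-refl , eq))
  ...   | no neq₁ | no neq₂ = no caught-now
    where
    caught-now : ¬ CaughtWithin G σ τ (suc m)
    caught-now (t , inj₁ (t≤1+m , eq)) with m≤n⇒m<n∨m≡n t≤1+m
    ... | inj₁ t<1+m = ¬caught (t , inj₁ (m<1+n⇒m≤n t<1+m , eq))
    ... | inj₂ refl = neq₁ eq
    caught-now (t , inj₂ (s≤s t≤m , eq)) with m≤n⇒m<n∨m≡n t≤m
    ... | inj₁ t<m = ¬caught (t , inj₂ (t<m , eq))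
    ... | inj₂ refl = neq₂ eq

module ProjectionChaser {n : ℕ} (G : Graph n) (α : ℕ) (2≤α : 2 ≤ α) (rankG : CornerRank G (fin α))
  (K : ℕ) (1≤K : 1 ≤ K) (K≤α : K ≤ α) (c₀ : Fin n) where
  open Ranked G α 2≤α rankG

  stepTowards : Fin n → Fin n → Fin n
  stepTowards c target = if adj G c target then target else c

  stepTowards-adj : ∀ c target → Adj c (stepTowards c target)
  stepTowards-adj c target with adj G c target in eq
  ... | true = subst T (sym eq) tt
  ... | false = Adj-refl c

  stepTowards-reaches : ∀ {c target} → Adj c target → stepTowards c target ≡ target
  stepTowards-reaches {c} {target} ct with adj G c target
  ... | true = refl

  -- Before the cop's (t+1)-st move the history is r_t ∷ c_t ∷ h with rounds h = t.
  chase : Strategy G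
  chase (r ∷ c ∷ h) = stepTowards c (proj (K ∸ rounds h) r)
  chase _ = c₀

  chase-legal : Legal G chase
  chase-legal r c h = stepTowards-adj c _

  module _ (c₀-standard : Dominating K c₀) (τ : Strategy G) (τ-legal : Legal G τ) where
    open Capture G chase τ

    c : ℕ → Fin n
    c = cpos G chase τ

    r : ℕ → Fin n
    r = rpos G chase τ

    mutual
      cop-on-projection : ∀ t → suc t ≤ K → c (suc t) ≡ proj (K ∸ t) (r t)
      cop-on-projection t t<K rewrite rounds-histC t = stepTowards-reaches (cop-near-projection t t<K)

      cop-near-projection : ∀ t → suc t ≤ K → Adj (c t) (proj (K ∸ t) (r t))
      cop-near-projection zero _ = c₀-standard _ (InF-∈ (proj-InF (r zero) 1≤K K≤α))
      cop-near-projection (suc t) t+1<K =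
        let L≡ = ∸-suc {K} {t} (<⇒≤ t+1<K)
            1≤L = subst (1 ≤_) (sym (∸-suc t+1<K)) (s≤s z≤n)
            L+1≤α = subst (_≤ α) L≡ (≤-trans (m∸n≤m K t) K≤α)
            cop∈F = subst (InF G (suc (K ∸ suc t)) (r t))
                      (sym (trans (cop-on-projection t (<⇒≤ t+1<K)) (cong (λ L → proj L (r t)) L≡)))
                      (proj-InF (r t) (s≤s z≤n) L+1≤α)
        in InF-step-adj cop∈F (τ-legal _ _ _) (proj-InF (r (suc t)) 1≤L (<⇒≤ L+1≤α))

    chase-catches : CaughtWithin G chase τ K
    chase-catches =
      K ∸ 1 , inj₂ (K-1<K , trans (cop-on-projection (K ∸ 1) K-1<K)
                                  (cong (λ L → proj L (r (K ∸ 1))) K∸[K∸1]≡1))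
      where
      K-1<K : suc (K ∸ 1) ≤ K
      K-1<K = ≤-reflexive (suc-∸1 1≤K)
      K∸[K∸1]≡1 : K ∸ (K ∸ 1) ≡ 1
      K∸[K∸1]≡1 = m∸[m∸n]≡n 1≤K

module EvasionBound {n : ℕ} (G : Graph n) (α : ℕ) (2≤α : 2 ≤ α) (rankG : CornerRank G (fin α))
  (K : ℕ) (K≤α : K ≤ α)
  (no-dominating : 1 ≤ K ∸ 1 → ∀ {w} → Stages.In G (K ∸ 1) w → ¬ Stages.Dominating G (K ∸ 1) w)
  where
  open Ranked G α 2≤α rankG

  -- What the lower bound needs from the robber; both a Higher Way strategy and evader have it.
  Evasive : Strategy G → Set
  Evasive τ = ∀ σ → Legal G σ → ∀ t → suc t ≤ K → FreeBeforeRobber G σ τ t →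
    let c = cpos G σ τ t ; L = K ∸ suc t in
    rpos G σ τ t ≢ c ×
    (1 ≤ L → (∀ d → InF G L c d → ∃ λ x → Reach G σ τ t x × In L x × ¬ Adj d x) →
      ∃ λ k → L ≤ k × ProjSafe G k c (rpos G σ τ t))

  module _ (τ : Strategy G) (τ-evasive : Evasive τ) (σ : Strategy G) (σ-legal : Legal G σ) where
    open Capture G σ τ

    c : ℕ → Fin n
    c = cpos G σ τ

    r : ℕ → Fin n
    r = rpos G σ τ

    level : ℕ → ℕ
    level t = K ∸ suc t

    1≤level : ∀ {t} → suc (suc t) ≤ K → 1 ≤ level t
    1≤level t+2≤K = subst (1 ≤_) (sym (∸-suc t+2≤K)) (s≤s z≤n)

    level≤α : ∀ t → level t ≤ α
    level≤α t = ≤-trans (m∸n≤m K (suc t)) K≤α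

    Ahead : ℕ → Set
    Ahead t = In (level t) (r t) × ∃ λ c' → InF G (level t) (c t) c' × ¬ Adj c' (r t)

    -- Being ahead after his t-th move keeps the robber uncaught in the next round and, by
    -- escape, lets him get ahead again after his next move.
    mutual
      free : ∀ t → suc t ≤ K → FreeBeforeRobber G σ τ t
      free zero _ = (λ _ ()) , (λ _ ())
      free (suc t) t+2≤K =
        let (r∈ , _ , pc , ¬adj) = ahead t t+2≤K
            ¬c~r = ¬adj-InF (1≤level t+2≤K) (level≤α t) r∈ pc ¬adj
        in FreeBeforeRobber-suc (free t (<⇒≤ t+2≤K)) (apart t (<⇒≤ t+2≤K))
             (λ c'≡r → ¬c~r (subst (Adj (c t)) c'≡r (σ-legal _ _ _)))

      apart : ∀ t → suc t ≤ K → r t ≢ c t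
      apart t t<K = proj₁ (τ-evasive σ σ-legal t t<K (free t t<K))

      ahead : ∀ t → suc (suc t) ≤ K → Ahead t
      ahead t t+2≤K =
        let (k , L≤k , atLeast , c' , pc' , c'r≡false) =
              proj₂ (τ-evasive σ σ-legal t (<⇒≤ t+2≤K) (free t (<⇒≤ t+2≤K)))
                (1≤level t+2≤K) (escapes t t+2≤K)
            (r∈ , _) = crAtLeast⇒ atLeast
        in 𝒢-anti-mono L≤k r∈ , InF-¬adj-lower (1≤level t+2≤K) L≤k r∈ pc' (≡false⇒¬T c'r≡false)

      escapes : ∀ t → suc (suc t) ≤ K → ∀ d → InF G (level t) (c t) d →
        ∃ λ x → Reach G σ τ t x × In (level t) x × ¬ Adj d x
      escapes zero 2≤K d pd =
        let (x , x∈ , ¬dx) =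
              ¬Dominating⇒nonNeighbour {K ∸ 1} (no-dominating (1≤level 2≤K) (InF-∈ pd))
        in x , tt , x∈ , ¬dx
      escapes (suc t) t+3≤K d pd =
        let L≡ = ∸-suc {K} {suc t} (<⇒≤ t+3≤K)
            (r∈ , c' , pc' , ¬c'r) = ahead t (<⇒≤ t+3≤K)
        in escape (1≤level t+3≤K) (subst (_≤ α) L≡ (level≤α t)) (σ-legal _ _ _)
             (subst (λ L → In L (r t)) L≡ r∈) (subst (λ L → InF G L (c t) c') L≡ pc') ¬c'r pd

    evasive-survives : ∀ m → CaughtWithin G σ τ m → K ≤ m
    evasive-survives m caught with K ≤? m
    ... | yes K≤m = K≤m
    ... | no K≰m = ⊥-elim (not-caught caught)
      where
      m<K : m < K
      m<K = ≰⇒> K≰m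
      not-caught : ¬ CaughtWithin G σ τ m
      not-caught (t , inj₁ (t≤m , r≡c)) =
        apart t (≤-trans (s≤s t≤m) m<K) r≡c
      not-caught (t , inj₂ (t<m , c≡r)) =
        proj₂ (free (suc t) (≤-trans (s≤s t<m) m<K)) t ≤-refl c≡r

  reachable-ProjSafe : ∀ σ τ t → let c = cpos G σ τ t ; L = K ∸ suc t in 1 ≤ L →
    (∀ d → InF G L c d → ∃ λ x → Reach G σ τ t x × In L x × ¬ Adj d x) →
    ∃ λ x → Reach G σ τ t x × ProjSafe G L c x
  reachable-ProjSafe σ τ t 1≤L escapes =
    let c = cpos G σ τ t
        L≤α = ≤-trans (m∸n≤m K (suc t)) K≤α
        (x , rx , x∈ , ¬adj) = escapes (proj (K ∸ suc t) c) (proj-InF c 1≤L L≤α)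
    in x , rx , ProjSafe-proj 1≤L L≤α x∈ ¬adj

  higherWay⇒evasive : ∀ τ → HigherWay G τ → Evasive τ
  higherWay⇒evasive τ higherWay σ σ-legal t _ free with higherWay σ σ-legal t free
  ... | inj₁ (k , 1≤k , safe , maximal) =
    (λ r≡c → ProjSafe⇒¬adj 1≤k safe (subst (Adj _) (sym r≡c) (Adj-refl _))) ,
    λ 1≤L escapes → let (x , rx , x-safe) = reachable-ProjSafe σ τ t 1≤L escapes
                    in k , maximal _ x 1≤L rx x-safe , safe
  ... | inj₂ (none , r≢c) =
    r≢c ,
    λ 1≤L escapes → let (x , rx , x-safe) = reachable-ProjSafe σ τ t 1≤L escapes
                    in ⊥-elim (none (_ , x , 1≤L , rx , x-safe))

  Reachable : List (Fin n) → Fin n → Set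
  Reachable [] _ = ⊤
  Reachable (r ∷ _) x = Adj r x

  Reachable? : ∀ h x → Dec (Reachable h x)
  Reachable? [] _ = yes tt
  Reachable? (r ∷ _) x = Adj? r x

  lastPosition : List (Fin n) → Fin n → Fin n
  lastPosition [] c = c
  lastPosition (r ∷ _) _ = r

  lastPosition-reachable : ∀ h c → Reachable h (lastPosition h c)
  lastPosition-reachable [] _ = tt
  lastPosition-reachable (r ∷ _) _ = Adj-refl r

  Safe : ℕ → Fin n → Fin n → Set
  Safe L c x = In L x × ¬ Adj (proj L c) x × x ≢ c

  Safe? : ∀ L c x → Dec (Safe L c x)
  Safe? L c x = T? (𝒢 G L x) ×-dec (¬? (Adj? (proj L c) x) ×-dec ¬? (x ≟ c))

  evasion : ∀ c h L → ∃ λ y → Reachable h y ×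
    ((∃ λ x → Reachable h x × Safe L c x) → Safe L c y) ×
    ((∃ λ x → Reachable h x × x ≢ c) → y ≢ c)
  evasion c h L with any? (λ x → Reachable? h x ×-dec Safe? L c x)
  ... | yes (x , rx , safe) = x , rx , (λ _ → safe) , (λ _ → proj₂ (proj₂ safe))
  ... | no ¬safe with any? (λ x → Reachable? h x ×-dec ¬? (x ≟ c))
  ...   | yes (x , rx , x≢c) = x , rx , ⊥-elim ∘ ¬safe , (λ _ → x≢c)
  ...   | no stuck = lastPosition h c , lastPosition-reachable h c , ⊥-elim ∘ ¬safe , ⊥-elim ∘ stuck

  evader : Strategy G
  evader (c ∷ h) = proj₁ (evasion c h (K ∸ suc (rounds h)))
  evader [] = v₀

  evader-legal : Legal G evader
  evader-legal c r h = proj₁ (proj₂ (evasion c (r ∷ h) _))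

  evader-evasive : Evasive evader
  evader-evasive σ σ-legal t _ free rewrite Capture.rounds-histC G σ evader t =
    proj₂ (proj₂ (proj₂ (evasion cop hist L))) (reachable-apart t free) ,
    λ 1≤L escapes →
      let L≤α = ≤-trans (m∸n≤m K (suc t)) K≤α
          (x , rx , x∈ , ¬adj) = escapes (proj L cop) (proj-InF cop 1≤L L≤α)
          x≢c x≡c = ¬adj-InF 1≤L L≤α x∈ (proj-InF cop 1≤L L≤α) ¬adj
                      (subst (Adj cop) (sym x≡c) (Adj-refl cop))
          (y∈ , ¬adj-y , _) = proj₁ (proj₂ (proj₂ (evasion cop hist L)))
                                (x , reachable t rx , x∈ , ¬adj , x≢c)
      in L , ≤-refl , ProjSafe-proj 1≤L L≤α y∈ ¬adj-y
    where
    cop : Fin n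
    cop = cpos G σ evader t
    hist : List (Fin n)
    hist = histC G σ evader t
    L : ℕ
    L = K ∸ suc t
    reachable : ∀ t {x} → Reach G σ evader t x → Reachable (histC G σ evader t) x
    reachable zero _ = tt
    reachable (suc t) rx = rx
    reachable-apart : ∀ t → FreeBeforeRobber G σ evader t →
      ∃ λ x → Reachable (histC G σ evader t) x × x ≢ cpos G σ evader t
    reachable-apart zero _ = let (x , x≢c) = another-vertex (cpos G σ evader zero) in x , tt , x≢c
    reachable-apart (suc t) free =
      rpos G σ evader t , Adj-refl _ , λ r≡c → proj₂ free t ≤-refl (sym r≡c)

module CaptureTime {n : ℕ} (G : Graph n) (α r : ℕ) (2≤α : 2 ≤ α) (rankG : CornerRank G (fin α))
  (copWin : CopWinType G α r) where
  open Ranked G α 2≤α rankG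
  open CopWinLevel (copWinLevel copWin)

  K : ℕ
  K = α ∸ r

  open ProjectionChaser G α 2≤α rankG K 1≤K (m∸n≤m α r) c₀
    using (chase; chase-legal; chase-catches)
  open EvasionBound G α 2≤α rankG K (m∸n≤m α r) no-dominating
    using (evader; evader-legal; evader-evasive; evasive-survives; higherWay⇒evasive)

  Capt⇒≡K : ∀ {m} → Capt G m → m ≡ K
  Capt⇒≡K ((σ , σ-legal , σ-wins) , optimal) =
    ≤-antisym (optimal chase K chase-legal (chase-catches c₀-standard))
              (evasive-survives evader evader-evasive σ σ-legal _ (σ-wins evader evader-legal))

  lowerWay-catches : ∀ σ → LowerWay G α r σ → ∀ τ → Legal G τ → CaughtWithin G σ τ K
  lowerWay-catches σ lowerWay τ τ-legal with Capture.CaughtWithin? G σ τ (K ∸ 1)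
  ... | yes caught = Capture.CaughtWithin-mono G σ τ (m∸n≤m K 1) caught
  ... | no ¬caught with proj₂ lowerWay τ τ-legal K 1≤K ¬caught
  ...   | zero , _ , c≡r =
    K ∸ 1 , inj₂ (≤-reflexive (suc-∸1 1≤K) ,
                  subst (λ t → cpos G σ τ t ≡ rpos G σ τ (K ∸ 1)) (sym (suc-∸1 1≤K)) c≡r)
  ...   | suc k , k<0 , _ = ⊥-elim (n≮0 (subst (suc k ≤_) (n∸n≡0 K) k<0))

  lowerWay-optimal : ∀ σ → Legal G σ → LowerWay G α r σ → OptimalCop G σ
  lowerWay-optimal σ _ lowerWay m capt τ τ-legal =
    subst (CaughtWithin G σ τ) (sym (Capt⇒≡K capt)) (lowerWay-catches σ lowerWay τ τ-legal)

  higherWay-optimal : ∀ τ → Legal G τ → HigherWay G τ → OptimalRobber G τ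
  higherWay-optimal τ _ higherWay m capt σ σ-legal m' caught =
    subst (_≤ m') (sym (Capt⇒≡K capt))
      (evasive-survives τ (higherWay⇒evasive τ higherWay) σ σ-legal m' caught)

theorem6p2 : ∀ {n} (G : Graph (suc n)) (α r : ℕ) → 2 ≤ α →
    CornerRank G (fin α) → CopWinType G α r →
    (∀ σ → Legal G σ → LowerWay G α r σ → OptimalCop G σ) ×
    (∀ τ → Legal G τ → HigherWay G τ → OptimalRobber G τ)
theorem6p2 G α r 2≤α rankG copWin = lowerWay-optimal , higherWay-optimal
  where open CaptureTime G α r 2≤α rankG copWin
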